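{- Let $\lambda\in\mathbb{R}$, let $\alpha$ be a positive integer and let $m\in\mathbb{N}$ with $m\ge\alpha$. Then \[ \sum_{k=\alpha}^{m}(k)_{\alpha,\lambda}=\sum_{k=1}^{m}S_{2,\lambda}(\alpha,k)\,k!\binom{m+1}{k+1}-\sum_{k=1}^{\alpha-1}S_{2,\lambda}(\alpha,k)\,k!\binom{\alpha}{k+1}. \]
   Context: For $\lambda\in\mathbb{R}$, the generalized falling factorial polynomials are $(x)_{0,\lambda}=1$ and $(x)_{n,\lambda}=x(x-\lambda)\cdots(x-(n-1)\lambda)$ for $n\ge1$. The ordinary falling factorial is $(x)_0=1$, $(x)_n=x(x-1)\cdots(x-n+1)$. The degenerate Stirling numbers of the second kind $S_{2,\lambda}(n,k)$ are defined by $(x)_{n,\lambda}=\sum_{k=0}^{n}S_{2,\lambda}(n,k)(x)_{k}$ for all $n\ge 0$, with $S_{2,\lambda}(n,k)=0$ for $k>n$ or $k<0$. -}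

module Defs where

open import Data.Nat using (ℕ; zero; suc) renaming (_+_ to _+ℕ_; _∸_ to _∸ℕ_)
open import Algebra.Bundles using (CommutativeRing)
import Level
import Data.Nat

-- Everything is developed over an arbitrary commutative ring R
-- (the paper's setting is R = ℝ, which has no counterpart in agda-stdlib).
module _ {c ℓ} (R : CommutativeRing c ℓ) where
  open CommutativeRing R

  fromℕ : ℕ → Carrier
  fromℕ zero    = 0#
  fromℕ (suc n) = 1# + fromℕ n

  sumBelow : ℕ → (ℕ → Carrier) → Carrier
  sumBelow zero    f = 0#
  sumBelow (suc n) f = sumBelow n f + f n

  -- ∑_{k=a}^{b} f k  (empty, i.e. 0, when a > b)
  sumFromTo : ℕ → ℕ → (ℕ → Carrier) → Carrier
  sumFromTo a b f = sumBelow (suc b ∸ℕ a) (λ i → f (a +ℕ i))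

  genFalling : Carrier → Carrier → ℕ → Carrier
  genFalling lam x zero    = 1#
  genFalling lam x (suc n) = genFalling lam x n * (x - fromℕ n * lam)

  falling : Carrier → ℕ → Carrier
  falling x zero    = 1#
  falling x (suc n) = falling x n * (x - fromℕ n)

  -- S is (a choice of) the degenerate Stirling numbers of the second kind
  -- S_{2,λ}(n,k): it satisfies the defining expansion
  --   (x)_{n,λ} = ∑_{k=0}^{n} S(n,k) (x)_k   for all n and all x,
  -- and S(n,k) = 0 for k > n.
  record IsDegStirling2 (lam : Carrier) (S : ℕ → ℕ → Carrier) : Set (c Level.⊔ ℓ) where
    field
      expansion : ∀ (n : ℕ) (x : Carrier) →
                  genFalling lam x n ≈ sumFromTo 0 n (λ k → S n k * falling x k)
      vanish    : ∀ (n k : ℕ) → n Data.Nat.< k → S n k ≈ 0#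

{-# OPTIONS --safe #-}
-- Expanding (α+i)_{α,λ} in the ordinary falling factorials and swapping the sums
-- reduces the left side to Σ_j S(α,j) Σ_i (α+i)_j.  At a natural number,
-- (k)_j = j! C(k,j), and the inner sum telescopes by Pascal's rule (hockey stick):
-- Σ_{i<n} C(α+i,j) = C(α+n,j+1) − C(α,j+1).  Since S(α,0) = 0 and S(α,j) = 0 for
-- j > α, the two resulting sums over 0 ≤ j ≤ α are the two sums of the statement.
module Submission where

open import Defs
open import Level using (Level)
open import Data.Nat using (ℕ; zero; suc; _≤_; _!; s≤s; z≤n; _≤′_; ≤′-refl; ≤′-step)
  renaming (_+_ to _+ℕ_; _*_ to _*ℕ_; _∸_ to _∸ℕ_)
open import Data.Nat.Properties as ℕ using (≤⇒≤′)
open import Data.Nat.Combinatorics using (_C_; k>n⇒nCk≡0; nCk+nC[k+1]≡[n+1]C[k+1])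
open import Data.Nat.Tactic.RingSolver using (solve-∀)
open import Algebra.Bundles using (CommutativeRing)
import Algebra.Properties.CommutativeSemigroup as CommutativeSemigroupProperties
import Algebra.Properties.AbelianGroup as AbelianGroupProperties
import Algebra.Properties.Group as GroupProperties
import Algebra.Properties.Ring as RingProperties
import Algebra.Properties.Semiring.Mult as SemiringMultProperties
import Relation.Binary.PropositionalEquality as ≡
open ≡ using (_≡_)

module Sums {c ℓ} (R : CommutativeRing c ℓ) where
  open CommutativeRing R
  open CommutativeSemigroupProperties +-commutativeSemigroup using (interchange)
  open GroupProperties +-group using (//-rightDividesˡ; //-rightDividesʳ; \\-leftDividesʳ)
  open import Relation.Binary.Reasoning.Setoid setoid

  sumBelow-cong : ∀ n {f g : ℕ → Carrier} → (∀ i → f i ≈ g i) →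
                  sumBelow R n f ≈ sumBelow R n g
  sumBelow-cong zero    f≈g = refl
  sumBelow-cong (suc n) f≈g = +-cong (sumBelow-cong n f≈g) (f≈g n)

  sumBelow-0 : ∀ n → sumBelow R n (λ _ → 0#) ≈ 0#
  sumBelow-0 zero    = refl
  sumBelow-0 (suc n) = trans (+-identityʳ _) (sumBelow-0 n)

  sumBelow-+ : ∀ n (f g : ℕ → Carrier) →
               sumBelow R n (λ i → f i + g i) ≈ sumBelow R n f + sumBelow R n g
  sumBelow-+ zero    f g = sym (+-identityˡ 0#)
  sumBelow-+ (suc n) f g = trans (+-congʳ (sumBelow-+ n f g)) (interchange _ _ _ _)

  sumBelow-- : ∀ n (f g : ℕ → Carrier) →
               sumBelow R n (λ i → f i - g i) ≈ sumBelow R n f - sumBelow R n g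
  sumBelow-- n f g = begin
    sumBelow R n (λ i → f i - g i)                           ≈⟨ //-rightDividesʳ _ _ ⟨
    (sumBelow R n (λ i → f i - g i) + sumBelow R n g) - Σg   ≈⟨ +-congʳ (sumBelow-+ n _ g) ⟨
    sumBelow R n (λ i → (f i - g i) + g i) - Σg              ≈⟨ +-congʳ (sumBelow-cong n (λ i → //-rightDividesˡ (g i) (f i))) ⟩
    sumBelow R n f - Σg                                      ∎
    where Σg = sumBelow R n g

  sumBelow-*ˡ : ∀ n a (f : ℕ → Carrier) → sumBelow R n (λ i → a * f i) ≈ a * sumBelow R n f
  sumBelow-*ˡ zero    a f = sym (zeroʳ a)
  sumBelow-*ˡ (suc n) a f = trans (+-congʳ (sumBelow-*ˡ n a f)) (sym (distribˡ _ _ _))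

  sumBelow-comm : ∀ n p (f : ℕ → ℕ → Carrier) →
    sumBelow R n (λ i → sumBelow R p (f i)) ≈ sumBelow R p (λ j → sumBelow R n (λ i → f i j))
  sumBelow-comm zero    p f = sym (sumBelow-0 p)
  sumBelow-comm (suc n) p f =
    trans (+-congʳ (sumBelow-comm n p f)) (sym (sumBelow-+ p _ (f n)))

  sumBelow-tail : ∀ n (f : ℕ → Carrier) → f 0 ≈ 0# →
                  sumBelow R (suc n) f ≈ sumBelow R n (λ i → f (suc i))
  sumBelow-tail zero    f f0≈0 = trans (+-identityˡ _) f0≈0
  sumBelow-tail (suc n) f f0≈0 = +-congʳ (sumBelow-tail n f f0≈0)

  sumBelow-truncate : ∀ {p n} (f : ℕ → Carrier) → (∀ k → p ≤ k → f k ≈ 0#) → p ≤ n →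
                      sumBelow R n f ≈ sumBelow R p f
  sumBelow-truncate {p} f vanish p≤n = go (≤⇒≤′ p≤n)
    where
    go : ∀ {n} → p ≤′ n → sumBelow R n f ≈ sumBelow R p f
    go ≤′-refl                = refl
    go (≤′-step {n} p≤′n) =
      trans (+-cong (go p≤′n) (vanish n (ℕ.≤′⇒≤ p≤′n))) (+-identityʳ _)

  sumBelow-telescope : ∀ n (f : ℕ → Carrier) →
                       sumBelow R n (λ i → f (suc i) - f i) ≈ f n - f 0
  sumBelow-telescope zero    f = sym (-‿inverseʳ (f 0))
  sumBelow-telescope (suc n) f = begin
    sumBelow R n (λ i → f (suc i) - f i) + (f (suc n) - f n) ≈⟨ +-congʳ (sumBelow-telescope n f) ⟩
    (f n - f 0) + (f (suc n) - f n)                         ≈⟨ +-comm _ _ ⟩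
    (f (suc n) - f n) + (f n - f 0)                         ≈⟨ +-assoc _ _ _ ⟩
    f (suc n) + (- f n + (f n - f 0))                       ≈⟨ +-congˡ (\\-leftDividesʳ (f n) (- f 0)) ⟩
    f (suc n) - f 0                                         ∎

module FallingFactorials {c ℓ} (R : CommutativeRing c ℓ) where
  open CommutativeRing R
  open CommutativeSemigroupProperties +-commutativeSemigroup using (interchange)
  open GroupProperties +-group using (//-rightDividesˡ; //-rightDividesʳ; ε⁻¹≈ε)
  open AbelianGroupProperties +-abelianGroup using (⁻¹-∙-comm)
  open SemiringMultProperties semiring using (_×_; ×-homo-+; ×1-homo-*)
  open Sums R
  open import Relation.Binary.Reasoning.Setoid setoid

  fromℕ≈×1# : ∀ n → fromℕ R n ≈ n × 1#
  fromℕ≈×1# zero    = refl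
  fromℕ≈×1# (suc n) = +-congˡ (fromℕ≈×1# n)

  fromℕ-homo-+ : ∀ m n → fromℕ R (m +ℕ n) ≈ fromℕ R m + fromℕ R n
  fromℕ-homo-+ m n = begin
    fromℕ R (m +ℕ n)          ≈⟨ fromℕ≈×1# (m +ℕ n) ⟩
    (m +ℕ n) × 1#             ≈⟨ ×-homo-+ 1# m n ⟩
    m × 1# + n × 1#           ≈⟨ +-cong (fromℕ≈×1# m) (fromℕ≈×1# n) ⟨
    fromℕ R m + fromℕ R n     ∎

  fromℕ-homo-* : ∀ m n → fromℕ R (m *ℕ n) ≈ fromℕ R m * fromℕ R n
  fromℕ-homo-* m n = begin
    fromℕ R (m *ℕ n)          ≈⟨ fromℕ≈×1# (m *ℕ n) ⟩
    (m *ℕ n) × 1#             ≈⟨ ×1-homo-* m n ⟩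
    m × 1# * n × 1#           ≈⟨ *-cong (fromℕ≈×1# m) (fromℕ≈×1# n) ⟨
    fromℕ R m * fromℕ R n     ∎

  fromℕ-cong : ∀ {m n} → m ≡ n → fromℕ R m ≈ fromℕ R n
  fromℕ-cong m≡n = reflexive (≡.cong (fromℕ R) m≡n)

  falling-0# : ∀ j → falling R 0# (suc j) ≈ 0#
  falling-0# zero    = trans (*-identityˡ _) (-‿inverseʳ 0#)
  falling-0# (suc j) = trans (*-congʳ (falling-0# j)) (zeroˡ _)

  falling-1+ : ∀ x j → falling R (1# + x) (suc j) ≈ (1# + x) * falling R x j
  falling-1+ x zero    = begin
    1# * ((1# + x) - 0#)    ≈⟨ *-identityˡ _ ⟩
    (1# + x) - 0#           ≈⟨ +-congˡ ε⁻¹≈ε ⟩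
    (1# + x) + 0#           ≈⟨ +-identityʳ _ ⟩
    1# + x                  ≈⟨ *-identityʳ _ ⟨
    (1# + x) * 1#           ∎
  falling-1+ x (suc j) = begin
    falling R (1# + x) (suc j) * ((1# + x) - (1# + fromℕ R j))
      ≈⟨ *-cong (falling-1+ x j) shift-difference ⟩
    ((1# + x) * falling R x j) * (x - fromℕ R j)
      ≈⟨ *-assoc _ _ _ ⟩
    (1# + x) * falling R x (suc j) ∎
    where
    shift-difference : (1# + x) - (1# + fromℕ R j) ≈ x - fromℕ R j
    shift-difference = begin
      (1# + x) - (1# + fromℕ R j)        ≈⟨ +-congˡ (⁻¹-∙-comm 1# (fromℕ R j)) ⟨
      (1# + x) + (- 1# - fromℕ R j)      ≈⟨ interchange _ _ _ _ ⟩
      (1# - 1#) + (x - fromℕ R j)        ≈⟨ +-congʳ (-‿inverseʳ 1#) ⟩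
      0# + (x - fromℕ R j)               ≈⟨ +-identityˡ _ ⟩
      x - fromℕ R j                      ∎

  falling-pascal : ∀ x j →
    falling R (1# + x) (suc j) ≈ falling R x (suc j) + fromℕ R (suc j) * falling R x j
  falling-pascal x j = begin
    falling R (1# + x) (suc j)                 ≈⟨ falling-1+ x j ⟩
    (1# + x) * A                               ≈⟨ *-comm _ _ ⟩
    A * (1# + x)                               ≈⟨ *-congˡ split ⟩
    A * ((x - y) + (1# + y))                   ≈⟨ distribˡ _ _ _ ⟩
    A * (x - y) + A * (1# + y)                 ≈⟨ +-congˡ (*-comm _ _) ⟩
    falling R x (suc j) + (1# + y) * A         ∎
    where
    A = falling R x j
    y = fromℕ R j
    split : 1# + x ≈ (x - y) + (1# + y)
    split = begin
      1# + x                  ≈⟨ +-comm _ _ ⟩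
      x + 1#                  ≈⟨ +-congʳ (//-rightDividesˡ y x) ⟨
      ((x - y) + y) + 1#      ≈⟨ +-assoc _ _ _ ⟩
      (x - y) + (y + 1#)      ≈⟨ +-congˡ (+-comm _ _) ⟩
      (x - y) + (1# + y)      ∎

  falling-fromℕ : ∀ k j → falling R (fromℕ R k) j ≈ fromℕ R (j ! *ℕ (k C j))
  falling-fromℕ k       zero    = sym (+-identityʳ 1#)
  falling-fromℕ zero    (suc j) =
    trans (falling-0# j) (fromℕ-cong (≡.sym (ℕ.*-zeroʳ (suc j !))))
  falling-fromℕ (suc k) (suc j) = begin
    falling R (1# + fromℕ R k) (suc j)
      ≈⟨ falling-pascal (fromℕ R k) j ⟩
    falling R (fromℕ R k) (suc j) + fromℕ R (suc j) * falling R (fromℕ R k) j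
      ≈⟨ +-cong (falling-fromℕ k (suc j)) (*-congˡ (falling-fromℕ k j)) ⟩
    fromℕ R (suc j ! *ℕ (k C suc j)) + fromℕ R (suc j) * fromℕ R (j ! *ℕ (k C j))
      ≈⟨ +-congˡ (fromℕ-homo-* (suc j) (j ! *ℕ (k C j))) ⟨
    fromℕ R (suc j ! *ℕ (k C suc j)) + fromℕ R (suc j *ℕ (j ! *ℕ (k C j)))
      ≈⟨ fromℕ-homo-+ (suc j ! *ℕ (k C suc j)) (suc j *ℕ (j ! *ℕ (k C j))) ⟨
    fromℕ R (suc j ! *ℕ (k C suc j) +ℕ suc j *ℕ (j ! *ℕ (k C j)))
      ≈⟨ fromℕ-cong (collect (suc j) (j !) (k C j) (k C suc j)) ⟩
    fromℕ R (suc j ! *ℕ (k C j +ℕ k C suc j))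
      ≈⟨ fromℕ-cong (≡.cong (suc j ! *ℕ_) (nCk+nC[k+1]≡[n+1]C[k+1] k j)) ⟩
    fromℕ R (suc j ! *ℕ (suc k C suc j)) ∎
    where
    collect : ∀ s f a b → s *ℕ f *ℕ b +ℕ s *ℕ (f *ℕ a) ≡ s *ℕ f *ℕ (a +ℕ b)
    collect = solve-∀

  sumBelow-binomial : ∀ a n j →
    sumBelow R n (λ i → fromℕ R ((a +ℕ i) C j))
      ≈ fromℕ R ((a +ℕ n) C suc j) - fromℕ R (a C suc j)
  sumBelow-binomial a n j = begin
    sumBelow R n (λ i → fromℕ R ((a +ℕ i) C j))   ≈⟨ sumBelow-cong n pascal-difference ⟩
    sumBelow R n (λ i → f (suc i) - f i)           ≈⟨ sumBelow-telescope n f ⟩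
    f n - f 0                                      ≈⟨ +-congˡ (-‿cong (fromℕ-cong (≡.cong (_C suc j) (ℕ.+-identityʳ a)))) ⟩
    f n - fromℕ R (a C suc j)                      ∎
    where
    f : ℕ → Carrier
    f i = fromℕ R ((a +ℕ i) C suc j)
    pascal-difference : ∀ i → fromℕ R ((a +ℕ i) C j) ≈ f (suc i) - f i
    pascal-difference i = begin
      fromℕ R (N C j)                                  ≈⟨ //-rightDividesʳ (f i) _ ⟨
      (fromℕ R (N C j) + fromℕ R (N C suc j)) - f i    ≈⟨ +-congʳ (fromℕ-homo-+ (N C j) (N C suc j)) ⟨
      fromℕ R (N C j +ℕ N C suc j) - f i               ≈⟨ +-congʳ (fromℕ-cong (nCk+nC[k+1]≡[n+1]C[k+1] N j)) ⟩
      fromℕ R (suc N C suc j) - f i                    ≈⟨ +-congʳ (fromℕ-cong (≡.cong (_C suc j) (ℕ.+-suc a i))) ⟨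
      f (suc i) - f i                                  ∎
      where N = a +ℕ i

  sumBelow-falling-fromℕ : ∀ a n j →
    sumBelow R n (λ i → falling R (fromℕ R (a +ℕ i)) j)
      ≈ fromℕ R (j !) * (fromℕ R ((a +ℕ n) C suc j) - fromℕ R (a C suc j))
  sumBelow-falling-fromℕ a n j = begin
    sumBelow R n (λ i → falling R (fromℕ R (a +ℕ i)) j)
      ≈⟨ sumBelow-cong n (λ i → trans (falling-fromℕ (a +ℕ i) j) (fromℕ-homo-* (j !) _)) ⟩
    sumBelow R n (λ i → fromℕ R (j !) * fromℕ R ((a +ℕ i) C j))
      ≈⟨ sumBelow-*ˡ n (fromℕ R (j !)) _ ⟩
    fromℕ R (j !) * sumBelow R n (λ i → fromℕ R ((a +ℕ i) C j))
      ≈⟨ *-congˡ (sumBelow-binomial a n j) ⟩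
    fromℕ R (j !) * (fromℕ R ((a +ℕ n) C suc j) - fromℕ R (a C suc j)) ∎

  genFalling-0# : ∀ lam n → genFalling R lam 0# (suc n) ≈ 0#
  genFalling-0# lam zero    = begin
    1# * (0# - 0# * lam)   ≈⟨ *-identityˡ _ ⟩
    0# - 0# * lam          ≈⟨ +-congˡ (-‿cong (zeroˡ lam)) ⟩
    0# - 0#                ≈⟨ -‿inverseʳ 0# ⟩
    0#                     ∎
  genFalling-0# lam (suc n) = trans (*-congʳ (genFalling-0# lam n)) (zeroˡ _)

module DegenerateStirling {c ℓ} (R : CommutativeRing c ℓ)
  {lam : CommutativeRing.Carrier R} {S : ℕ → ℕ → CommutativeRing.Carrier R}
  (isS : IsDegStirling2 R lam S) where
  open CommutativeRing R
  open IsDegStirling2 isS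
  open RingProperties ring using (x[y-z]≈xy-xz)
  open Sums R
  open FallingFactorials R
  open import Relation.Binary.Reasoning.Setoid setoid

  S[1+a,0]≈0 : ∀ a → S (suc a) 0 ≈ 0#
  S[1+a,0]≈0 a = begin
    S α 0                              ≈⟨ *-identityʳ _ ⟨
    S α 0 * 1#                         ≈⟨ +-identityˡ _ ⟨
    sumBelow R 1 g                     ≈⟨ sumBelow-truncate g higher-terms (s≤s z≤n) ⟨
    sumBelow R (suc α) g               ≈⟨ expansion α 0# ⟨
    genFalling R lam 0# α              ≈⟨ genFalling-0# lam a ⟩
    0#                                 ∎
    where
    α = suc a
    g : ℕ → Carrier
    g k = S α k * falling R 0# k
    higher-terms : ∀ k → 1 ≤ k → g k ≈ 0#
    higher-terms (suc k) _ = trans (*-congˡ (falling-0# k)) (zeroʳ _)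

  sumBelow-genFalling-fromℕ : ∀ α a n →
    sumBelow R n (λ i → genFalling R lam (fromℕ R (a +ℕ i)) α)
      ≈ sumBelow R (suc α) (λ j → S α j * fromℕ R (j !) * fromℕ R ((a +ℕ n) C suc j))
        - sumBelow R (suc α) (λ j → S α j * fromℕ R (j !) * fromℕ R (a C suc j))
  sumBelow-genFalling-fromℕ α a n = begin
    sumBelow R n (λ i → genFalling R lam (fromℕ R (a +ℕ i)) α)
      ≈⟨ sumBelow-cong n (λ i → expansion α (fromℕ R (a +ℕ i))) ⟩
    sumBelow R n (λ i → sumBelow R (suc α) (λ j → S α j * falling R (fromℕ R (a +ℕ i)) j))
      ≈⟨ sumBelow-comm n (suc α) _ ⟩
    sumBelow R (suc α) (λ j → sumBelow R n (λ i → S α j * falling R (fromℕ R (a +ℕ i)) j))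
      ≈⟨ sumBelow-cong (suc α) inner-sum ⟩
    sumBelow R (suc α) (λ j → S α j * fromℕ R (j !) * fromℕ R ((a +ℕ n) C suc j)
                              - S α j * fromℕ R (j !) * fromℕ R (a C suc j))
      ≈⟨ sumBelow-- (suc α) _ _ ⟩
    sumBelow R (suc α) (λ j → S α j * fromℕ R (j !) * fromℕ R ((a +ℕ n) C suc j))
      - sumBelow R (suc α) (λ j → S α j * fromℕ R (j !) * fromℕ R (a C suc j)) ∎
    where
    inner-sum : ∀ j →
      sumBelow R n (λ i → S α j * falling R (fromℕ R (a +ℕ i)) j)
        ≈ S α j * fromℕ R (j !) * fromℕ R ((a +ℕ n) C suc j)
          - S α j * fromℕ R (j !) * fromℕ R (a C suc j)
    inner-sum j = begin
      sumBelow R n (λ i → S α j * falling R (fromℕ R (a +ℕ i)) j)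
        ≈⟨ sumBelow-*ˡ n (S α j) _ ⟩
      S α j * sumBelow R n (λ i → falling R (fromℕ R (a +ℕ i)) j)
        ≈⟨ *-congˡ (sumBelow-falling-fromℕ a n j) ⟩
      S α j * (fromℕ R (j !) * (fromℕ R ((a +ℕ n) C suc j) - fromℕ R (a C suc j)))
        ≈⟨ *-assoc _ _ _ ⟨
      S α j * fromℕ R (j !) * (fromℕ R ((a +ℕ n) C suc j) - fromℕ R (a C suc j))
        ≈⟨ x[y-z]≈xy-xz _ _ _ ⟩
      S α j * fromℕ R (j !) * fromℕ R ((a +ℕ n) C suc j)
        - S α j * fromℕ R (j !) * fromℕ R (a C suc j) ∎

theorem2 : ∀ {c ℓ : Level} (R : CommutativeRing c ℓ) →
    let open CommutativeRing R in
    ∀ (lam : Carrier) (S : ℕ → ℕ → Carrier) → IsDegStirling2 R lam S →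
    ∀ (α m : ℕ) → 1 ≤ α → α ≤ m →
    sumFromTo R α m (λ k → genFalling R lam (fromℕ R k) α)
      ≈ (sumFromTo R 1 m (λ k → S α k * fromℕ R (k !) * fromℕ R ((m +ℕ 1) C (k +ℕ 1)))
         - sumFromTo R 1 (α ∸ℕ 1) (λ k → S α k * fromℕ R (k !) * fromℕ R (α C (k +ℕ 1))))
theorem2 R lam S isS α@(suc a) m (s≤s z≤n) α≤m =
  trans (sumBelow-genFalling-fromℕ α α n) (+-cong upper (-‿cong lower))
  where
  open CommutativeRing R
  open IsDegStirling2 isS using (vanish)
  open Sums R
  open FallingFactorials R using (fromℕ-cong)
  open DegenerateStirling R isS
  open import Relation.Binary.Reasoning.Setoid setoid
  n = suc m ∸ℕ α

  term : ℕ → ℕ → Carrier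
  term N j = S α j * fromℕ R (j !) * fromℕ R (N C suc j)

  term-vanishes : ∀ N j → S α j ≈ 0# → term N j ≈ 0#
  term-vanishes N j S≈0 = trans (*-congʳ (trans (*-congʳ S≈0) (zeroˡ _))) (zeroˡ _)

  reindex : ∀ {N N'} → N ≡ N' → ∀ i →
    term N (suc i) ≈ S α (suc i) * fromℕ R (suc i !) * fromℕ R (N' C (suc i +ℕ 1))
  reindex N≡N' i = reflexive (≡.cong₂ (λ N k → S α (suc i) * fromℕ R (suc i !) * fromℕ R (N C k))
                                      N≡N' (ℕ.+-comm 1 (suc i)))

  upper : sumBelow R (suc α) (term (α +ℕ n))
          ≈ sumBelow R m (λ i → S α (suc i) * fromℕ R (suc i !) * fromℕ R ((m +ℕ 1) C (suc i +ℕ 1)))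
  upper = begin
    sumBelow R (suc α) (term (α +ℕ n))     ≈⟨ sumBelow-tail α _ (term-vanishes (α +ℕ n) 0 (S[1+a,0]≈0 a)) ⟩
    sumBelow R α (λ i → term (α +ℕ n) (suc i))
      ≈⟨ sumBelow-truncate _ (λ k α≤k → term-vanishes (α +ℕ n) (suc k) (vanish α (suc k) (s≤s α≤k))) α≤m ⟨
    sumBelow R m (λ i → term (α +ℕ n) (suc i))
      ≈⟨ sumBelow-cong m (reindex (≡.trans (ℕ.m+[n∸m]≡n (ℕ.m≤n⇒m≤1+n α≤m)) (ℕ.+-comm 1 m))) ⟩
    _ ∎

  lower : sumBelow R (suc α) (term α)
          ≈ sumBelow R a (λ i → S α (suc i) * fromℕ R (suc i !) * fromℕ R (α C (suc i +ℕ 1)))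
  lower = begin
    sumBelow R (suc α) (term α)            ≈⟨ sumBelow-tail α _ (term-vanishes α 0 (S[1+a,0]≈0 a)) ⟩
    sumBelow R α (λ i → term α (suc i))    ≈⟨ sumBelow-truncate _ beyond-a (ℕ.n≤1+n a) ⟩
    sumBelow R a (λ i → term α (suc i))    ≈⟨ sumBelow-cong a (reindex {α} ≡.refl) ⟩
    _ ∎
    where
    beyond-a : ∀ k → a ≤ k → term α (suc k) ≈ 0#
    beyond-a k a≤k = trans (*-congˡ (fromℕ-cong (k>n⇒nCk≡0 (s≤s (s≤s a≤k))))) (zeroʳ _)
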